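{- For every spanoid $\mathcal S$ on $[n]$, $\mathrm{rank}(\mathcal S)$ equals the minimum size of a set $H\subseteq[n]$ that intersects every nonempty open set of $\mathcal S$.
   Context: A spanoid $\mathcal S$ on $[n]$ is a family of pairs $(S,i)$ with $S\subseteq[n]$, $i\in[n]$ (rules). For $T\subseteq[n]$, $i\in[n]$ write $T\models i$ if there is a sequence $T=T_0,\dots,T_r$ ($r\ge0$) with $i\in T_r$ such that for each $j\in[r]$, $T_j=T_{j-1}\cup\{i_j\}$ where some $S\subseteq T_{j-1}$ has $(S,i_j)\in\mathcal S$. $\mathrm{span}(T)=\{i:T\models i\}$; $\mathrm{rank}(\mathcal S)$ is the minimum size of $T$ with $\mathrm{span}(T)=[n]$. A set $B\subseteq[n]$ is closed if $\mathrm{span}(B)=B$, and open if its complement $[n]\setminus B$ is closed. -}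

module Defs where

open import Data.Nat using (ℕ; _≤_)
open import Data.Fin using (Fin)
open import Data.Fin.Subset using (Subset; _∈_; _⊆_; _∪_; ⁅_⁆; ∁; ∣_∣; Nonempty)
open import Data.List using (List)
open import Data.List.Membership.Propositional using () renaming (_∈_ to _∈ₗ_)
open import Data.Product using (Σ; ∃; _×_; _,_)
open import Relation.Binary.PropositionalEquality using (_≡_)

-- A spanoid on [n] = Fin n: a (finite) family of rules (S , i).
Spanoid : ℕ → Set
Spanoid n = List (Subset n × Fin n)

data Reach {n : ℕ} (𝒮 : Spanoid n) (T : Subset n) : Subset n → Set where
  base : Reach 𝒮 T T
  step : ∀ {U S k} → Reach 𝒮 T U → (S , k) ∈ₗ 𝒮 → S ⊆ U → Reach 𝒮 T (U ∪ ⁅ k ⁆)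

_⊨[_]_ : {n : ℕ} → Subset n → Spanoid n → Fin n → Set
T ⊨[ 𝒮 ] i = ∃ λ U → Reach 𝒮 T U × i ∈ U

Spans : {n : ℕ} → Spanoid n → Subset n → Set
Spans 𝒮 T = ∀ i → T ⊨[ 𝒮 ] i

IsClosed : {n : ℕ} → Spanoid n → Subset n → Set
IsClosed 𝒮 B = ∀ i → (B ⊨[ 𝒮 ] i → i ∈ B) × (i ∈ B → B ⊨[ 𝒮 ] i)

IsOpen : {n : ℕ} → Spanoid n → Subset n → Set
IsOpen 𝒮 B = IsClosed 𝒮 (∁ B)

HitsOpens : {n : ℕ} → Spanoid n → Subset n → Set
HitsOpens 𝒮 H = ∀ B → IsOpen 𝒮 B → Nonempty B → ∃ λ i → i ∈ H × i ∈ B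

IsMinSize : {n : ℕ} → (Subset n → Set) → ℕ → Set
IsMinSize P k = (∃ λ T → P T × ∣ T ∣ ≡ k) × (∀ T → P T → k ≤ ∣ T ∣)

IsRank : {n : ℕ} → Spanoid n → ℕ → Set
IsRank 𝒮 k = IsMinSize (Spans 𝒮) k

module Submission where

-- The theorem is a consequence of one fact: a set H spans [n] if and only if
-- H meets every nonempty open set.  Both sides are then minimising the size
-- of the same family of sets, so the two minima coincide.
--
-- The key tool is the closure of a set T: repeatedly firing rules whose
-- premises are already derived and whose conclusion is new terminates (each
-- firing enlarges the current set) in a set V reachable from T that is
-- closed under all rules.  Everything derivable from T lies in V, so V is
-- span(T) and is closed, making ∁ V open.
--   * If H meets every nonempty open set, the open set ∁ (closure H) must be
--     empty, as it is disjoint from H; hence H spans.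
--   * If T spans and B is nonempty and open, then T cannot lie inside the
--     closed set ∁ B, since ∁ B would then contain span(T) = [n]; so T meets B.
-- The closure also makes spanning decidable, which is what is needed to pick
-- a spanning set of minimum size among the finitely many subsets of [n].

open import Defs
open import Data.Bool using (not)
open import Data.Bool.Properties using (not-involutive)
open import Data.Nat using (ℕ; zero; suc; _+_; _≤_; _<_; _<?_)
open import Data.Nat.Properties
  using (≤-refl; ≤-trans; ≤-<-trans; <-≤-trans; <-irrefl; ≤-pred; +-suc; +-monoʳ-≤; m≤m+n; ≮⇒≥; n≮0)
open import Data.Fin using (Fin)
open import Data.Fin.Properties using (any?; all?)
open import Data.Fin.Subset using (Subset; _∈_; _∉_; _⊆_; _∪_; ⁅_⁆; ∁; ∣_∣; ⊤)
open import Data.Fin.Subset.Properties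
  using (_∈?_; _⊆?_; p⊆p∪q; x∈p∪q⁻; x∈p∪q⁺; x∈⁅x⁆; x∈⁅y⁆⇒x≡y; p⊂q⇒∣p∣<∣q∣; ∣p∣≤n;
         x∉p⇒x∈∁p; x∈∁p⇒x∉p; ∈⊤; anySubset?)
import Data.Vec as Vec
open import Data.Vec.Properties using (map-∘; map-cong; map-id)
open import Data.List.Relation.Unary.Any using () renaming (any? to anyRule?)
open import Data.List.Membership.Propositional using (find; lose) renaming (_∈_ to _∈ₗ_)
open import Data.Product using (∃; _×_; _,_; proj₁; proj₂)
open import Data.Sum using (_⊎_; inj₁; inj₂)
open import Function using (id; _∘_)
open import Relation.Nullary using (yes; no; contradiction)
open import Relation.Nullary.Decidable using (_×-dec_)
open import Relation.Unary using (Decidable)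
open import Relation.Binary.PropositionalEquality using (_≡_; refl; subst; sym; module ≡-Reasoning)

∁-involutive : ∀ {m} (p : Subset m) → ∁ (∁ p) ≡ p
∁-involutive p = begin
  ∁ (∁ p)            ≡⟨ sym (map-∘ not not p) ⟩
  Vec.map (not ∘ not) p ≡⟨ map-cong not-involutive p ⟩
  Vec.map id p          ≡⟨ map-id p ⟩
  p                  ∎
  where open ≡-Reasoning

∪⁅⁆-least : ∀ {m} {U V : Subset m} {k} → U ⊆ V → k ∈ V → U ∪ ⁅ k ⁆ ⊆ V
∪⁅⁆-least {U = U} {V} {k} U⊆V k∈V x∈ with x∈p∪q⁻ U ⁅ k ⁆ x∈
... | inj₁ x∈U = U⊆V x∈U
... | inj₂ x∈k = subst (_∈ V) (sym (x∈⁅y⁆⇒x≡y k x∈k)) k∈V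

∪-new-grows : ∀ {m} {U : Subset m} {k} → k ∉ U → ∣ U ∣ < ∣ U ∪ ⁅ k ⁆ ∣
∪-new-grows {k = k} k∉U = p⊂q⇒∣p∣<∣q∣ (p⊆p∪q ⁅ k ⁆ , k , x∈p∪q⁺ (inj₂ (x∈⁅x⁆ k)) , k∉U)

module _ {n : ℕ} (𝒮 : Spanoid n) where

  RuleClosed : Subset n → Set
  RuleClosed U = ∀ {S k} → (S , k) ∈ₗ 𝒮 → S ⊆ U → k ∈ U

  reach-⊇ : ∀ {T U} → Reach 𝒮 T U → T ⊆ U
  reach-⊇ base x∈T = x∈T
  reach-⊇ (step {k = k} r _ _) x∈T = p⊆p∪q ⁅ k ⁆ (reach-⊇ r x∈T)

  reach-⊆-ruleClosed : ∀ {V T U} → RuleClosed V → T ⊆ V → Reach 𝒮 T U → U ⊆ V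
  reach-⊆-ruleClosed closed T⊆V base = T⊆V
  reach-⊆-ruleClosed closed T⊆V (step r rule S⊆U) =
    ∪⁅⁆-least U⊆V (closed rule (U⊆V ∘ S⊆U))
    where U⊆V = reach-⊆-ruleClosed closed T⊆V r

  ⊨-ruleClosed : ∀ {V T i} → RuleClosed V → T ⊆ V → T ⊨[ 𝒮 ] i → i ∈ V
  ⊨-ruleClosed closed T⊆V (U , r , i∈U) = reach-⊆-ruleClosed closed T⊆V r i∈U

  ruleClosed⇒closed : ∀ {V} → RuleClosed V → IsClosed 𝒮 V
  ruleClosed⇒closed closed i = ⊨-ruleClosed closed id , λ i∈V → _ , base , i∈V

  reach-mono : ∀ {T C U} → T ⊆ C → Reach 𝒮 T U → ∃ λ W → Reach 𝒮 C W × U ⊆ W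
  reach-mono T⊆C base = _ , base , T⊆C
  reach-mono T⊆C (step {k = k} r rule S⊆U) with reach-mono T⊆C r
  ... | W , r′ , U⊆W =
    W ∪ ⁅ k ⁆ , step r′ rule (U⊆W ∘ S⊆U) ,
    ∪⁅⁆-least (p⊆p∪q ⁅ k ⁆ ∘ U⊆W) (x∈p∪q⁺ (inj₂ (x∈⁅x⁆ k)))

  ⊨-closed : ∀ {C T i} → IsClosed 𝒮 C → T ⊆ C → T ⊨[ 𝒮 ] i → i ∈ C
  ⊨-closed {i = i} closed T⊆C (U , r , i∈U) with reach-mono T⊆C r
  ... | W , r′ , U⊆W = proj₁ (closed i) (W , r′ , U⊆W i∈U)

  Fires : Subset n → Subset n × Fin n → Set
  Fires U (S , k) = (∀ x → x ∈ S → x ∈ U) × k ∉ U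

  fires? : ∀ U → Decidable (Fires U)
  fires? U (S , k) with S ⊆? U | k ∈? U
  ... | yes S⊆U | no k∉U = yes ((λ x → S⊆U {x}) , k∉U)
  ... | yes _   | yes k∈U = no (λ fires → proj₂ fires k∈U)
  ... | no S⊈U  | _ = no (λ fires → S⊈U (λ {x} → proj₁ fires x))

  ruleClosed-or-fires : ∀ U → RuleClosed U ⊎ ∃ λ rule → rule ∈ₗ 𝒮 × Fires U rule
  ruleClosed-or-fires U with anyRule? (fires? U) 𝒮
  ... | yes some = inj₂ (find some)
  ... | no none = inj₁ closed
    where
    closed : RuleClosed U
    closed {S} {k} rule S⊆U with k ∈? U
    ... | yes k∈U = k∈U
    ... | no k∉U = contradiction (lose rule ((λ x → S⊆U {x}) , k∉U)) none

  -- Fire rules until none applies.  The fuel bounds the number of elements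
  -- that can still be added, so running out of it with a rule still firing
  -- is impossible.
  saturate : (fuel : ℕ) → ∀ {T U} → Reach 𝒮 T U → n ≤ fuel + ∣ U ∣ →
             ∃ λ V → Reach 𝒮 T V × RuleClosed V
  saturate fuel {U = U} r bound with ruleClosed-or-fires U
  ... | inj₁ closed = U , r , closed
  ... | inj₂ ((S , k) , rule , S⊆U , k∉U) = continue fuel bound
    where
    grows : ∣ U ∣ < ∣ U ∪ ⁅ k ⁆ ∣
    grows = ∪-new-grows k∉U

    continue : (fuel : ℕ) → n ≤ fuel + ∣ U ∣ → ∃ λ V → Reach 𝒮 _ V × RuleClosed V
    continue zero bound′ =
      contradiction (<-≤-trans (≤-<-trans bound′ grows) (∣p∣≤n (U ∪ ⁅ k ⁆))) (<-irrefl refl)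
    continue (suc fuel) bound′ =
      saturate fuel (step r rule (λ {x} → S⊆U x))
        (≤-trans bound′ (subst (_≤ fuel + ∣ U ∪ ⁅ k ⁆ ∣) (+-suc fuel ∣ U ∣) (+-monoʳ-≤ fuel grows)))

  closure : ∀ T → ∃ λ V → Reach 𝒮 T V × RuleClosed V
  closure T = saturate n base (m≤m+n n ∣ T ∣)

  -- Spanning is decidable: T spans iff its closure is all of [n].
  spans? : Decidable (Spans 𝒮)
  spans? T with closure T
  ... | V , r , closed with all? (_∈? V)
  ... | yes everything = yes (λ i → V , r , everything i)
  ... | no ¬everything =
    no (λ spans → ¬everything (λ i → ⊨-ruleClosed closed (reach-⊇ r) (spans i)))

  -- A set meeting every nonempty open set spans: otherwise the complement of
  -- its closure would be a nonempty open set disjoint from it.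
  hits⇒spans : ∀ H → HitsOpens 𝒮 H → Spans 𝒮 H
  hits⇒spans H hits i with closure H
  ... | V , r , closed with i ∈? V
  ... | yes i∈V = V , r , i∈V
  ... | no i∉V with hits (∁ V) ∁V-open (i , x∉p⇒x∈∁p i∉V)
    where
    ∁V-open : IsOpen 𝒮 (∁ V)
    ∁V-open = subst (IsClosed 𝒮) (sym (∁-involutive V)) (ruleClosed⇒closed closed)
  ... | j , j∈H , j∈∁V = contradiction (reach-⊇ r j∈H) (x∈∁p⇒x∉p j∈∁V)

  -- A spanning set meets every nonempty open set B: if it were disjoint from B
  -- it would lie in the closed set ∁ B, which would then contain all of [n].
  spans⇒hits : ∀ T → Spans 𝒮 T → HitsOpens 𝒮 T
  spans⇒hits T spans B B-open (i , i∈B) with any? (λ j → j ∈? T ×-dec j ∈? B)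
  ... | yes meets = meets
  ... | no disjoint = contradiction i∈B (x∈∁p⇒x∉p (⊨-closed B-open T⊆∁B (spans i)))
    where
    T⊆∁B : T ⊆ ∁ B
    T⊆∁B {x} x∈T = x∉p⇒x∈∁p (λ x∈B → disjoint (x , x∈T , x∈B))

-- A decidable property of subsets that holds for some subset has a minimum
-- size: descend through ever smaller witnesses, at most |T| times.
minimum-exists : ∀ {n} {P : Subset n → Set} → Decidable P → ∀ {T} → P T → ∃ (IsMinSize P)
minimum-exists {P = P} P? {T} pT = descend ∣ T ∣ T ≤-refl pT
  where
  descend : (bound : ℕ) → ∀ T → ∣ T ∣ ≤ bound → P T → ∃ (IsMinSize P)
  descend bound T size pT with anySubset? (λ T′ → P? T′ ×-dec (∣ T′ ∣ <? ∣ T ∣))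
  ... | no none-smaller =
    ∣ T ∣ , (T , pT , refl) , λ T′ pT′ → ≮⇒≥ (λ smaller → none-smaller (T′ , pT′ , smaller))
  descend zero T size pT | yes (_ , _ , smaller) = contradiction (<-≤-trans smaller size) n≮0
  descend (suc bound) T size pT | yes (T′ , pT′ , smaller) =
    descend bound T′ (≤-pred (≤-trans smaller size)) pT′

minSize-transfer : ∀ {n} {P Q : Subset n → Set} {k} →
                   (∀ T → P T → Q T) → (∀ T → Q T → P T) → IsMinSize P k → IsMinSize Q k
minSize-transfer P⇒Q Q⇒P ((T , pT , size) , minimal) =
  (T , P⇒Q T pT , size) , λ T′ qT′ → minimal T′ (Q⇒P T′ qT′)

mainTheorem8 : (n : ℕ) (𝒮 : Spanoid n) →
    ∃ λ k → IsRank 𝒮 k × IsMinSize (HitsOpens 𝒮) k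
mainTheorem8 n 𝒮 with minimum-exists (spans? 𝒮) {⊤} (λ i → ⊤ , base , ∈⊤)
... | k , rank = k , rank , minSize-transfer (spans⇒hits 𝒮) (hits⇒spans 𝒮) rank
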